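{- Let $x=(x_1,\dots,x_5)$ be an integer Büchi sequence of length $5$ which is canonical, and let $M_x$ be as defined in the context. If $x$ is trivial, then $M_x=B$ or $M_x=B^{ -1}$.
   Context: An integer Büchi sequence of length $N$ is $(x_1,\dots,x_N)\in\mathbb{Z}^N$ with $x_{i+2}^2-2x_{i+1}^2+x_i^2=2$ for $1\le i\le N-2$; it is trivial if there is $m\in\mathbb{Z}$ with $x_i^2=(m+i)^2$ for all $i$. A sequence $(x_1,\dots,x_5)\in\mathbb{Z}^5$ is canonical if $x_1\equiv x_5\equiv 2\pmod 8$ and either ($x_4\equiv 1$ or $-3$ and $x_2\equiv -1$ or $3\pmod 8$) or ($x_4\equiv -1$ or $3$ and $x_2\equiv 1$ or $-3\pmod 8$). Let $B=\begin{pmatrix}3&4&0\\2&3&0\\0&0&1\end{pmatrix}$, $J=\begin{pmatrix}0&0&1\\0&1&0\\1&0&0\end{pmatrix}$, and let $H$ be the subgroup of $\mathrm{GL}_3(\mathbb{Z})$ generated by $B$ and $J$, acting on column vectors. For a canonical Büchi sequence $x$, both $(x_1,x_2,x_3)$ and $(x_3,x_4,x_5)$ lie in the $H$-orbit $\{M(2,1,0)^T: M\in H\}$, and there are unique $M_1,M_3\in H$ with $(x_1,x_2,x_3)^T=M_1(2,1,0)^T$ and $(x_3,x_4,x_5)^T=M_3(2,1,0)^T$; set $M_x=JM_3M_1^{ -1}$. -}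

module Defs where

open import Data.Integer using (ℤ; +_; -[1+_]; _+_; _-_; _*_; -_)
open import Data.Integer.Divisibility using (_∣_)
open import Data.Vec using (Vec; []; _∷_; lookup; map; foldr; zipWith; tabulate)
open import Data.Fin using (Fin)
open import Data.Product using (∃; _×_)
open import Data.Sum using (_⊎_)
open import Relation.Binary.PropositionalEquality using (_≡_)

-- 3×3 integer matrices as rows; column vectors as Vec ℤ 3
Vec3 : Set
Vec3 = Vec ℤ 3

Mat3 : Set
Mat3 = Vec (Vec ℤ 3) 3

dot : Vec3 → Vec3 → ℤ
dot u v = foldr _ _+_ (+ 0) (zipWith _*_ u v)

col : Mat3 → Fin 3 → Vec3
col M j = map (λ r → lookup r j) M

infixr 5 _·v_
_·v_ : Mat3 → Vec3 → Vec3
M ·v v = map (λ r → dot r v) M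

infixl 7 _⊗_
_⊗_ : Mat3 → Mat3 → Mat3
M ⊗ N = map (λ r → tabulate (λ j → dot r (col N j))) M

I3 : Mat3
I3 = (+ 1 ∷ + 0 ∷ + 0 ∷ []) ∷ (+ 0 ∷ + 1 ∷ + 0 ∷ []) ∷ (+ 0 ∷ + 0 ∷ + 1 ∷ []) ∷ []

B : Mat3
B = (+ 3 ∷ + 4 ∷ + 0 ∷ []) ∷ (+ 2 ∷ + 3 ∷ + 0 ∷ []) ∷ (+ 0 ∷ + 0 ∷ + 1 ∷ []) ∷ []

Binv : Mat3
Binv = (+ 3 ∷ - + 4 ∷ + 0 ∷ []) ∷ (- + 2 ∷ + 3 ∷ + 0 ∷ []) ∷ (+ 0 ∷ + 0 ∷ + 1 ∷ []) ∷ []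

J : Mat3
J = (+ 0 ∷ + 0 ∷ + 1 ∷ []) ∷ (+ 0 ∷ + 1 ∷ + 0 ∷ []) ∷ (+ 1 ∷ + 0 ∷ + 0 ∷ []) ∷ []

-- H = subgroup of GL₃(ℤ) generated by B and J (J⁻¹ = J)
data InH : Mat3 → Set where
  h-id   : InH I3
  h-B    : InH B
  h-Binv : InH Binv
  h-J    : InH J
  h-mul  : ∀ {M N} → InH M → InH N → InH (M ⊗ N)

base : Vec3
base = + 2 ∷ + 1 ∷ + 0 ∷ []

sq : ℤ → ℤ
sq a = a * a

infix 4 _≡₈_
_≡₈_ : ℤ → ℤ → Set
a ≡₈ b = (+ 8) ∣ (a - b)

IsBuchi5 : ℤ → ℤ → ℤ → ℤ → ℤ → Set
IsBuchi5 x1 x2 x3 x4 x5 =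
  (sq x3 - (+ 2) * sq x2 + sq x1 ≡ + 2) ×
  (sq x4 - (+ 2) * sq x3 + sq x2 ≡ + 2) ×
  (sq x5 - (+ 2) * sq x4 + sq x3 ≡ + 2)

IsTrivial5 : ℤ → ℤ → ℤ → ℤ → ℤ → Set
IsTrivial5 x1 x2 x3 x4 x5 = ∃ λ m →
  (sq x1 ≡ sq (m + + 1)) × (sq x2 ≡ sq (m + + 2)) × (sq x3 ≡ sq (m + + 3)) ×
  (sq x4 ≡ sq (m + + 4)) × (sq x5 ≡ sq (m + + 5))

IsCanonical5 : ℤ → ℤ → ℤ → ℤ → ℤ → Set
IsCanonical5 x1 x2 x3 x4 x5 =
  (x1 ≡₈ + 2) × (x5 ≡₈ + 2) ×
  ( ( ((x4 ≡₈ + 1) ⊎ (x4 ≡₈ - + 3)) × ((x2 ≡₈ - + 1) ⊎ (x2 ≡₈ + 3)) )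
  ⊎ ( ((x4 ≡₈ - + 1) ⊎ (x4 ≡₈ + 3)) × ((x2 ≡₈ + 1) ⊎ (x2 ≡₈ - + 3)) ) )

module Submission where

-- The structural input is that H acts freely on the orbit of base = (2,1,0)ᵀ:
-- an element of H fixing base is the identity.  This is a ping-pong argument.
-- Every element of H is a reduced word in the letters B, B⁻¹, J (no factor
-- BB⁻¹, B⁻¹B or JJ).  Each letter owns a region of vectors, cut out by the
-- ratio of the first two coordinates; a letter maps the regions of all
-- letters allowed to follow it in a reduced word into its own region (for J
-- this uses that H preserves q(x,y,z) = x² − 2y² + z², which is 2 on the
-- orbit), and base lies in no region, so no nonempty reduced word fixes base.
--
-- Independently, the congruences modulo 8 in the definition of "canonical"
-- pin down the signs in x_i = ±(m+i), which shows C(x₁,x₂,x₃)ᵀ = J(x₃,x₄,x₅)ᵀ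
-- for C = B or C = B⁻¹.  Then J M₃ and C M₁ agree on base, hence are equal by
-- freeness, and J M₃ M₁⁻¹ = C.

open import Defs
open import Data.Integer using (ℤ; +_; -[1+_]; _+_; _-_; _*_; -_; _◃_)
open import Data.Integer.Properties
  using (pos-*; *-zeroʳ; *-identityˡ; i*j≡0⇒i≡0∨j≡0; i-j≡0⇒i≡j; +-inverseʳ)
open import Data.Integer.Divisibility.Signed
  using (divides; _∣?_; ∣ᵤ⇒∣; ∣-trans; ∣m∣n⇒∣m+n; ∣m∣n⇒∣m-n)
  renaming (_∣_ to _∣ₛ_)
open import Data.Integer.Tactic.RingSolver using (solve-∀)
open import Data.Nat as ℕ using (ℕ; zero; suc)
open import Data.Sign as Sign using (Sign; opposite)
open import Data.Fin using (zero; suc)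
open import Data.List using (List; []; _∷_)
open import Data.List.Relation.Unary.Linked using (Linked; []; [-]; _∷_; tail)
open import Data.Vec using (Vec; []; _∷_; tabulate)
open import Data.Empty using (⊥-elim)
open import Data.Product using (Σ; _×_; _,_)
open import Data.Sum using (_⊎_; inj₁; inj₂)
import Data.Sum as Sum
open import Relation.Nullary using (¬_)
open import Relation.Nullary.Decidable using (False; toWitnessFalse)
open import Relation.Binary.PropositionalEquality
  using (_≡_; refl; sym; trans; cong; subst; module ≡-Reasoning)

-- Matrix algebra.  `dot` unfolds to  a₁ * b₁ + (a₂ * b₂ + (a₃ * b₃ + + 0)),
-- and the identities below are stated in that unfolded form.

≡-vec3 : ∀ {A : Set} {a b c a′ b′ c′ : A} → a ≡ a′ → b ≡ b′ → c ≡ c′ →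
         _≡_ {A = Vec A 3} (a ∷ b ∷ c ∷ []) (a′ ∷ b′ ∷ c′ ∷ [])
≡-vec3 refl refl refl = refl

-- (r N)·v = r·(N v) for a row r: the single identity behind associativity.
dot-reassoc : ∀ a₁ a₂ a₃ n₁₁ n₁₂ n₁₃ n₂₁ n₂₂ n₂₃ n₃₁ n₃₂ n₃₃ p₁ p₂ p₃ →
  (a₁ * n₁₁ + (a₂ * n₂₁ + (a₃ * n₃₁ + + 0))) * p₁
    + ((a₁ * n₁₂ + (a₂ * n₂₂ + (a₃ * n₃₂ + + 0))) * p₂
    + ((a₁ * n₁₃ + (a₂ * n₂₃ + (a₃ * n₃₃ + + 0))) * p₃ + + 0))
  ≡ a₁ * (n₁₁ * p₁ + (n₁₂ * p₂ + (n₁₃ * p₃ + + 0)))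
    + (a₂ * (n₂₁ * p₁ + (n₂₂ * p₂ + (n₂₃ * p₃ + + 0)))
    + (a₃ * (n₃₁ * p₁ + (n₃₂ * p₂ + (n₃₃ * p₃ + + 0))) + + 0))
dot-reassoc = solve-∀

dot-comm : ∀ a b c x y z →
  a * x + (b * y + (c * z + + 0)) ≡ x * a + (y * b + (z * c + + 0))
dot-comm = solve-∀

pick₁ : ∀ a b c → + 1 * a + (+ 0 * b + (+ 0 * c + + 0)) ≡ a
pick₁ = solve-∀

pick₂ : ∀ a b c → + 0 * a + (+ 1 * b + (+ 0 * c + + 0)) ≡ b
pick₂ = solve-∀

pick₃ : ∀ a b c → + 0 * a + (+ 0 * b + (+ 1 * c + + 0)) ≡ c
pick₃ = solve-∀

dot-plane : ∀ a b x y z → a * x + (b * y + (+ 0 * z + + 0)) ≡ a * x + b * y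
dot-plane = solve-∀

_⊙_ : Vec3 → Mat3 → Vec3
r ⊙ N = tabulate (λ j → dot r (col N j))

dot-⊙ : ∀ r N v → dot (r ⊙ N) v ≡ dot r (N ·v v)
dot-⊙ (a₁ ∷ a₂ ∷ a₃ ∷ [])
      ((n₁₁ ∷ n₁₂ ∷ n₁₃ ∷ []) ∷ (n₂₁ ∷ n₂₂ ∷ n₂₃ ∷ []) ∷ (n₃₁ ∷ n₃₂ ∷ n₃₃ ∷ []) ∷ [])
      (p₁ ∷ p₂ ∷ p₃ ∷ []) =
  dot-reassoc a₁ a₂ a₃ n₁₁ n₁₂ n₁₃ n₂₁ n₂₂ n₂₃ n₃₁ n₃₂ n₃₃ p₁ p₂ p₃

⊗-action : ∀ M N v → (M ⊗ N) ·v v ≡ M ·v (N ·v v)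
⊗-action (r₁ ∷ r₂ ∷ r₃ ∷ []) N v = ≡-vec3 (dot-⊙ r₁ N v) (dot-⊙ r₂ N v) (dot-⊙ r₃ N v)

⊙-assoc : ∀ r N P → (r ⊙ N) ⊙ P ≡ r ⊙ (N ⊗ P)
⊙-assoc r N@(_ ∷ _ ∷ _ ∷ []) P =
  ≡-vec3 (dot-⊙ r N (col P zero)) (dot-⊙ r N (col P (suc zero)))
         (dot-⊙ r N (col P (suc (suc zero))))

⊗-assoc : ∀ M N P → (M ⊗ N) ⊗ P ≡ M ⊗ (N ⊗ P)
⊗-assoc (r₁ ∷ r₂ ∷ r₃ ∷ []) N P = ≡-vec3 (⊙-assoc r₁ N P) (⊙-assoc r₂ N P) (⊙-assoc r₃ N P)

⊗-identityˡ : ∀ M → I3 ⊗ M ≡ M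
⊗-identityˡ ((a₁ ∷ a₂ ∷ a₃ ∷ []) ∷ (b₁ ∷ b₂ ∷ b₃ ∷ []) ∷ (c₁ ∷ c₂ ∷ c₃ ∷ []) ∷ []) =
  ≡-vec3 (≡-vec3 (pick₁ a₁ b₁ c₁) (pick₁ a₂ b₂ c₂) (pick₁ a₃ b₃ c₃))
         (≡-vec3 (pick₂ a₁ b₁ c₁) (pick₂ a₂ b₂ c₂) (pick₂ a₃ b₃ c₃))
         (≡-vec3 (pick₃ a₁ b₁ c₁) (pick₃ a₂ b₂ c₂) (pick₃ a₃ b₃ c₃))

⊗-identityʳ : ∀ M → M ⊗ I3 ≡ M
⊗-identityʳ (r₁ ∷ r₂ ∷ r₃ ∷ []) = ≡-vec3 (row r₁) (row r₂) (row r₃)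
  where
  row : ∀ r → r ⊙ I3 ≡ r
  row (a ∷ b ∷ c ∷ []) =
    ≡-vec3 (trans (dot-comm a b c (+ 1) (+ 0) (+ 0)) (pick₁ a b c))
           (trans (dot-comm a b c (+ 0) (+ 1) (+ 0)) (pick₂ a b c))
           (trans (dot-comm a b c (+ 0) (+ 0) (+ 1)) (pick₃ a b c))

cancel-left : ∀ {P Q} N → P ⊗ Q ≡ I3 → P ⊗ (Q ⊗ N) ≡ N
cancel-left {P} {Q} N PQ≡I = begin
  P ⊗ (Q ⊗ N)  ≡⟨ sym (⊗-assoc P Q N) ⟩
  (P ⊗ Q) ⊗ N  ≡⟨ cong (_⊗ N) PQ≡I ⟩
  I3 ⊗ N       ≡⟨ ⊗-identityˡ N ⟩
  N            ∎
  where open ≡-Reasoning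

product-inverse : ∀ {P Q M N} → P ⊗ M ≡ I3 → Q ⊗ N ≡ I3 → (Q ⊗ P) ⊗ (M ⊗ N) ≡ I3
product-inverse {P} {Q} {M} {N} PM≡I QN≡I = begin
  (Q ⊗ P) ⊗ (M ⊗ N)  ≡⟨ ⊗-assoc Q P (M ⊗ N) ⟩
  Q ⊗ (P ⊗ (M ⊗ N))  ≡⟨ cong (Q ⊗_) (cancel-left N PM≡I) ⟩
  Q ⊗ N              ≡⟨ QN≡I ⟩
  I3                 ∎
  where open ≡-Reasoning

B-action : ∀ x y z → B ·v (x ∷ y ∷ z ∷ []) ≡ (+ 3 * x + + 4 * y) ∷ (+ 2 * x + + 3 * y) ∷ z ∷ []
B-action x y z = ≡-vec3 (dot-plane (+ 3) (+ 4) x y z) (dot-plane (+ 2) (+ 3) x y z) (pick₃ x y z)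

Binv-action : ∀ x y z →
  Binv ·v (x ∷ y ∷ z ∷ []) ≡ (+ 3 * x + - + 4 * y) ∷ (- + 2 * x + + 3 * y) ∷ z ∷ []
Binv-action x y z =
  ≡-vec3 (dot-plane (+ 3) (- + 4) x y z) (dot-plane (- + 2) (+ 3) x y z) (pick₃ x y z)

J-action : ∀ x y z → J ·v (x ∷ y ∷ z ∷ []) ≡ z ∷ y ∷ x ∷ []
J-action x y z = ≡-vec3 (pick₃ x y z) (pick₂ x y z) (pick₁ x y z)

-- Reduced words over the generators B, B⁻¹, J of H.

data Letter : Set where
  b b⁻¹ j : Letter

⟦_⟧ : Letter → Mat3
⟦ b ⟧   = B
⟦ b⁻¹ ⟧ = Binv
⟦ j ⟧   = J

-- The pairs of letters allowed to stand next to each other in a reduced word.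
data _⌣_ : Letter → Letter → Set where
  b⌣b     : b ⌣ b
  b⌣j     : b ⌣ j
  b⁻¹⌣b⁻¹ : b⁻¹ ⌣ b⁻¹
  b⁻¹⌣j   : b⁻¹ ⌣ j
  j⌣b     : j ⌣ b
  j⌣b⁻¹   : j ⌣ b⁻¹

neighbours? : ∀ a c → a ⌣ c ⊎ ⟦ a ⟧ ⊗ ⟦ c ⟧ ≡ I3
neighbours? b   b   = inj₁ b⌣b
neighbours? b   b⁻¹ = inj₂ refl
neighbours? b   j   = inj₁ b⌣j
neighbours? b⁻¹ b   = inj₂ refl
neighbours? b⁻¹ b⁻¹ = inj₁ b⁻¹⌣b⁻¹
neighbours? b⁻¹ j   = inj₁ b⁻¹⌣j
neighbours? j   b   = inj₁ j⌣b
neighbours? j   b⁻¹ = inj₁ j⌣b⁻¹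
neighbours? j   j   = inj₂ refl

Word : Set
Word = List Letter

eval : Word → Mat3
eval []      = I3
eval (a ∷ w) = ⟦ a ⟧ ⊗ eval w

Reduced : Word → Set
Reduced = Linked _⌣_

ReducedWordFor : Mat3 → Set
ReducedWordFor M = Σ Word λ w → Reduced w × eval w ≡ M

prepend : ∀ a {M} → ReducedWordFor M → ReducedWordFor (⟦ a ⟧ ⊗ M)
prepend a ([] , _ , refl) = a ∷ [] , [-] , refl
prepend a (c ∷ w , reduced , refl) with neighbours? a c
... | inj₁ a⌣c    = a ∷ c ∷ w , a⌣c ∷ reduced , refl
... | inj₂ ac≡I = w , tail reduced , sym (cancel-left (eval w) ac≡I)

H-acts : ∀ {M N} → InH M → ReducedWordFor N → ReducedWordFor (M ⊗ N)
H-acts {N = N} h-id r = subst ReducedWordFor (sym (⊗-identityˡ N)) r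
H-acts h-B    r = prepend b r
H-acts h-Binv r = prepend b⁻¹ r
H-acts h-J    r = prepend j r
H-acts {N = N} (h-mul {M} {M′} hM hM′) r =
  subst ReducedWordFor (sym (⊗-assoc M M′ N)) (H-acts hM (H-acts hM′ r))

reduced-word : ∀ {M} → InH M → ReducedWordFor M
reduced-word {M} h = subst ReducedWordFor (⊗-identityʳ M) (H-acts h ([] , [] , refl))

Pos : ℤ → Set
Pos u = Σ ℕ λ n → u ≡ + suc n

NonNeg : ℤ → Set
NonNeg u = Σ ℕ λ n → u ≡ + n

pos⇒nonneg : ∀ {u} → Pos u → NonNeg u
pos⇒nonneg (n , u≡) = suc n , u≡

pos+nonneg : ∀ {u v} → Pos u → NonNeg v → Pos (u + v)
pos+nonneg (n , refl) (m , refl) = n ℕ.+ m , refl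

nonneg+nonneg : ∀ {u v} → NonNeg u → NonNeg v → NonNeg (u + v)
nonneg+nonneg (n , refl) (m , refl) = n ℕ.+ m , refl

pos*pos : ∀ {u v} → Pos u → Pos v → Pos (u * v)
pos*pos (n , refl) (m , refl) = m ℕ.+ n ℕ.* suc m , refl

nonneg*nonneg : ∀ {u v} → NonNeg u → NonNeg v → NonNeg (u * v)
nonneg*nonneg (n , refl) (m , refl) = n ℕ.* m , sym (pos-* n m)

pos-pred : ∀ {u} → Pos u → NonNeg (u - + 1)
pos-pred (n , refl) = n , refl

nonneg-suc : ∀ {u} → NonNeg u → Pos (+ 1 + u)
nonneg-suc (n , refl) = n , refl

not-pos-*0 : ∀ i → ¬ Pos (i * + 0)
not-pos-*0 i (n , eq) with trans (sym (*-zeroʳ i)) eq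
... | ()

pos-cancel : ∀ k {e} → Pos (+ suc k * e) → Pos e
pos-cancel k {+ suc n}   _       = n , refl
pos-cancel k {+ zero}    p       = ⊥-elim (not-pos-*0 (+ suc k) p)
pos-cancel k { -[1+ n ]} (_ , ())

pos-comb : ∀ k a c {e u v} → Pos u → NonNeg v →
           + suc k * e ≡ + suc a * u + + c * v → Pos e
pos-comb k a c u>0 v≥0 eq =
  pos-cancel k (subst Pos (sym eq) (pos+nonneg (pos*pos (a , refl) u>0)
                                               (nonneg*nonneg (c , refl) v≥0)))

quadratic-bound : ∀ {u v} → Pos u → NonNeg v → Pos (u * (+ 3 * u + + 2 * v) - + 2)
quadratic-bound {u} {v} u>0 v≥0 = subst Pos (sym (expand u v))
  (nonneg-suc (nonneg+nonneg
    (nonneg*nonneg (pos-pred u>0) three-u+two-v≥0)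
    (nonneg+nonneg (nonneg*nonneg (3 , refl) (pos-pred u>0)) (nonneg*nonneg (2 , refl) v≥0))))
  where
  three-u+two-v≥0 : NonNeg (+ 3 * u + + 2 * v)
  three-u+two-v≥0 = nonneg+nonneg (nonneg*nonneg (3 , refl) (pos⇒nonneg u>0))
                                  (nonneg*nonneg (2 , refl) v≥0)
  expand : ∀ u v → u * (+ 3 * u + + 2 * v) - + 2
         ≡ + 1 + ((u - + 1) * (+ 3 * u + + 2 * v) + (+ 3 * (u - + 1) + + 2 * v))
  expand = solve-∀

sgn : Sign → ℤ
sgn s = s ◃ 1

sgn-opposite : ∀ s → sgn (opposite s) ≡ - sgn s
sgn-opposite Sign.+ = refl
sgn-opposite Sign.- = refl

sgn-squared : ∀ s w → sgn s * sgn s * w ≡ w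
sgn-squared Sign.+ w = *-identityˡ w
sgn-squared Sign.- w = *-identityˡ w

SignedCone : (ℤ → Set) → ℤ → ℤ → Set
SignedCone P u v = Σ Sign λ s → Pos (sgn s * u) × P (sgn s * v)

split : ∀ u v → Pos (u * v) → SignedCone Pos u v
split (+ suc _)   (+ suc _)   _       = Sign.+ , (_ , refl) , (_ , refl)
split -[1+ _ ]    -[1+ _ ]    _       = Sign.- , (_ , refl) , (_ , refl)
split (+ zero)    _           (_ , ())
split (+ suc a)   (+ zero)    p       = ⊥-elim (not-pos-*0 (+ suc a) p)
split -[1+ a ]    (+ zero)    p       = ⊥-elim (not-pos-*0 -[1+ a ] p)
split (+ suc _)   -[1+ _ ]    (_ , ())
split -[1+ _ ]    (+ suc _)   (_ , ())

-- Ping-pong regions.  In terms of the slope t = x/y of the first two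
-- coordinates: B owns 1 < t < 2, B⁻¹ owns −2 ≤ t < −1, and J owns
-- |x| < |y| or |x| > 2|y|.  The half-open cone of B⁻¹ is forced by
-- B⁻¹ base = (2,−1,0)ᵀ, which has slope exactly −2.

Cone : Letter → ℤ → ℤ → Set
Cone b   x y = SignedCone Pos (x - y) (+ 2 * y - x)
Cone b⁻¹ x y = SignedCone NonNeg (x + y) (- x - + 2 * y)
Cone j   x y = Pos ((y - x) * (y + x)) ⊎ Pos ((x - + 2 * y) * (x + + 2 * y))

Region : Letter → Vec3 → Set
Region a (x ∷ y ∷ _ ∷ []) = Cone a x y

-- B maps the cones of B and J into the cone of B: in each case the two
-- coordinates of the image are positive combinations (e₁, e₂) of those of
-- the source, after the same sign s.
b-step : ∀ x y → Cone b x y ⊎ Cone j x y → Cone b (+ 3 * x + + 4 * y) (+ 2 * x + + 3 * y)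
b-step x y (inj₁ (s , u>0 , v>0)) =
  s , pos-comb 0 2 2 u>0 (pos⇒nonneg v>0) (e₁ (sgn s) x y)
    , pos-comb 0 3 3 u>0 (pos⇒nonneg v>0) (e₂ (sgn s) x y)
  where
  e₁ : ∀ t x y → + 1 * (t * ((+ 3 * x + + 4 * y) - (+ 2 * x + + 3 * y)))
                 ≡ + 3 * (t * (x - y)) + + 2 * (t * (+ 2 * y - x))
  e₁ = solve-∀
  e₂ : ∀ t x y → + 1 * (t * (+ 2 * (+ 2 * x + + 3 * y) - (+ 3 * x + + 4 * y)))
                 ≡ + 4 * (t * (x - y)) + + 3 * (t * (+ 2 * y - x))
  e₂ = solve-∀
b-step x y (inj₂ (inj₁ p)) with split (y - x) (y + x) p
... | s , u>0 , v>0 =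
  s , pos-comb 0 0 0 v>0 (pos⇒nonneg u>0) (e₁ (sgn s) x y)
    , pos-comb 1 2 1 v>0 (pos⇒nonneg u>0) (e₂ (sgn s) x y)
  where
  e₁ : ∀ t x y → + 1 * (t * ((+ 3 * x + + 4 * y) - (+ 2 * x + + 3 * y)))
                 ≡ + 1 * (t * (y + x)) + + 0 * (t * (y - x))
  e₁ = solve-∀
  e₂ : ∀ t x y → + 2 * (t * (+ 2 * (+ 2 * x + + 3 * y) - (+ 3 * x + + 4 * y)))
                 ≡ + 3 * (t * (y + x)) + + 1 * (t * (y - x))
  e₂ = solve-∀
b-step x y (inj₂ (inj₂ p)) with split (x - + 2 * y) (x + + 2 * y) p
... | s , u>0 , v>0 =
  s , pos-comb 3 2 1 v>0 (pos⇒nonneg u>0) (e₁ (sgn s) x y)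
    , pos-comb 0 0 0 v>0 (pos⇒nonneg u>0) (e₂ (sgn s) x y)
  where
  e₁ : ∀ t x y → + 4 * (t * ((+ 3 * x + + 4 * y) - (+ 2 * x + + 3 * y)))
                 ≡ + 3 * (t * (x + + 2 * y)) + + 1 * (t * (x - + 2 * y))
  e₁ = solve-∀
  e₂ : ∀ t x y → + 1 * (t * (+ 2 * (+ 2 * x + + 3 * y) - (+ 3 * x + + 4 * y)))
                 ≡ + 1 * (t * (x + + 2 * y)) + + 0 * (t * (x - + 2 * y))
  e₂ = solve-∀

-- B⁻¹ maps the cones of B⁻¹ and J into the cone of B⁻¹, in the same way;
-- coming from |x| < |y| the sign flips.
b⁻¹-step : ∀ x y → Cone b⁻¹ x y ⊎ Cone j x y →
           Cone b⁻¹ (+ 3 * x + - + 4 * y) (- + 2 * x + + 3 * y)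
b⁻¹-step x y (inj₁ (s , u>0 , v≥0)) =
  s , pos-comb 0 2 2 u>0 v≥0 (e₁ (sgn s) x y)
    , pos⇒nonneg (pos-comb 0 3 3 u>0 v≥0 (e₂ (sgn s) x y))
  where
  e₁ : ∀ t x y → + 1 * (t * ((+ 3 * x + - + 4 * y) + (- + 2 * x + + 3 * y)))
                 ≡ + 3 * (t * (x + y)) + + 2 * (t * (- x - + 2 * y))
  e₁ = solve-∀
  e₂ : ∀ t x y → + 1 * (t * (- (+ 3 * x + - + 4 * y) - + 2 * (- + 2 * x + + 3 * y)))
                 ≡ + 4 * (t * (x + y)) + + 3 * (t * (- x - + 2 * y))
  e₂ = solve-∀
b⁻¹-step x y (inj₂ (inj₁ p)) with split (y - x) (y + x) p
... | s , u>0 , v>0 =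
  opposite s
    , subst (λ t → Pos (t * _)) (sym (sgn-opposite s))
        (pos-comb 0 0 0 u>0 (pos⇒nonneg v>0) (e₁ (sgn s) x y))
    , subst (λ t → NonNeg (t * _)) (sym (sgn-opposite s))
        (pos⇒nonneg (pos-comb 1 2 1 u>0 (pos⇒nonneg v>0) (e₂ (sgn s) x y)))
  where
  e₁ : ∀ t x y → + 1 * (- t * ((+ 3 * x + - + 4 * y) + (- + 2 * x + + 3 * y)))
                 ≡ + 1 * (t * (y - x)) + + 0 * (t * (y + x))
  e₁ = solve-∀
  e₂ : ∀ t x y → + 2 * (- t * (- (+ 3 * x + - + 4 * y) - + 2 * (- + 2 * x + + 3 * y)))
                 ≡ + 3 * (t * (y - x)) + + 1 * (t * (y + x))
  e₂ = solve-∀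
b⁻¹-step x y (inj₂ (inj₂ p)) with split (x - + 2 * y) (x + + 2 * y) p
... | s , u>0 , v>0 =
  s , pos-comb 3 2 1 u>0 (pos⇒nonneg v>0) (e₁ (sgn s) x y)
    , pos⇒nonneg (pos-comb 0 0 0 u>0 (pos⇒nonneg v>0) (e₂ (sgn s) x y))
  where
  e₁ : ∀ t x y → + 4 * (t * ((+ 3 * x + - + 4 * y) + (- + 2 * x + + 3 * y)))
                 ≡ + 3 * (t * (x - + 2 * y)) + + 1 * (t * (x + + 2 * y))
  e₁ = solve-∀
  e₂ : ∀ t x y → + 1 * (t * (- (+ 3 * x + - + 4 * y) - + 2 * (- + 2 * x + + 3 * y)))
                 ≡ + 1 * (t * (x - + 2 * y)) + + 0 * (t * (x + + 2 * y))
  e₂ = solve-∀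

wide : ∀ x y → Cone b x y ⊎ Cone b⁻¹ x y → Pos ((x - y) * (x + y) - + 2)
wide x y (inj₁ (s , u>0 , v>0)) =
  subst (λ w → Pos (w - + 2)) (trans (factor (sgn s) x y) (sgn-squared s _))
        (quadratic-bound u>0 (pos⇒nonneg v>0))
  where
  factor : ∀ t x y → t * (x - y) * (+ 3 * (t * (x - y)) + + 2 * (t * (+ 2 * y - x)))
                     ≡ t * t * ((x - y) * (x + y))
  factor = solve-∀
wide x y (inj₂ (s , u>0 , v≥0)) =
  subst (λ w → Pos (w - + 2)) (trans (factor (sgn s) x y) (sgn-squared s _))
        (quadratic-bound u>0 v≥0)
  where
  factor : ∀ t x y → t * (x + y) * (+ 3 * (t * (x + y)) + + 2 * (t * (- x - + 2 * y)))
                     ≡ t * t * ((x - y) * (x + y))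
  factor = solve-∀

q : Vec3 → ℤ
q (x ∷ y ∷ z ∷ []) = x * x - + 2 * (y * y) + z * z

-- J maps the cones of B and B⁻¹ into the cone of J, on the level set q = 2:
-- there y² − z² = (x² − y²) − 2 > 0.
j-step : ∀ x y z → q (x ∷ y ∷ z ∷ []) ≡ + 2 → Cone b x y ⊎ Cone b⁻¹ x y → Cone j z y
j-step x y z q≡2 c =
  inj₁ (subst Pos (sym (trans (difference x y z) (cong (λ r → (x - y) * (x + y) - r) q≡2)))
              (wide x y c))
  where
  difference : ∀ x y z → (y - z) * (y + z) ≡ (x - y) * (x + y) - (x * x - + 2 * (y * y) + z * z)
  difference = solve-∀

q-invariant : ∀ a v → q (⟦ a ⟧ ·v v) ≡ q v
q-invariant b (x ∷ y ∷ z ∷ []) = trans (cong q (B-action x y z)) (invariance x y z)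
  where
  invariance : ∀ x y z → (+ 3 * x + + 4 * y) * (+ 3 * x + + 4 * y)
                         - + 2 * ((+ 2 * x + + 3 * y) * (+ 2 * x + + 3 * y)) + z * z
                       ≡ x * x - + 2 * (y * y) + z * z
  invariance = solve-∀
q-invariant b⁻¹ (x ∷ y ∷ z ∷ []) = trans (cong q (Binv-action x y z)) (invariance x y z)
  where
  invariance : ∀ x y z → (+ 3 * x + - + 4 * y) * (+ 3 * x + - + 4 * y)
                         - + 2 * ((- + 2 * x + + 3 * y) * (- + 2 * x + + 3 * y)) + z * z
                       ≡ x * x - + 2 * (y * y) + z * z
  invariance = solve-∀
q-invariant j (x ∷ y ∷ z ∷ []) = trans (cong q (J-action x y z)) (invariance x y z)
  where
  invariance : ∀ x y z → z * z - + 2 * (y * y) + x * x ≡ x * x - + 2 * (y * y) + z * z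
  invariance = solve-∀

q-orbit : ∀ w → q (eval w ·v base) ≡ + 2
q-orbit []      = refl
q-orbit (a ∷ w) = begin
  q ((⟦ a ⟧ ⊗ eval w) ·v base)  ≡⟨ cong q (⊗-action ⟦ a ⟧ (eval w) base) ⟩
  q (⟦ a ⟧ ·v (eval w ·v base)) ≡⟨ q-invariant a (eval w ·v base) ⟩
  q (eval w ·v base)            ≡⟨ q-orbit w ⟩
  + 2                           ∎
  where open ≡-Reasoning

region-step : ∀ {a c} → a ⌣ c → ∀ v → q v ≡ + 2 → Region c v → Region a (⟦ a ⟧ ·v v)
region-step b⌣b (x ∷ y ∷ z ∷ []) _ r =
  subst (Region b) (sym (B-action x y z)) (b-step x y (inj₁ r))
region-step b⌣j (x ∷ y ∷ z ∷ []) _ r =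
  subst (Region b) (sym (B-action x y z)) (b-step x y (inj₂ r))
region-step b⁻¹⌣b⁻¹ (x ∷ y ∷ z ∷ []) _ r =
  subst (Region b⁻¹) (sym (Binv-action x y z)) (b⁻¹-step x y (inj₁ r))
region-step b⁻¹⌣j (x ∷ y ∷ z ∷ []) _ r =
  subst (Region b⁻¹) (sym (Binv-action x y z)) (b⁻¹-step x y (inj₂ r))
region-step j⌣b (x ∷ y ∷ z ∷ []) q≡2 r =
  subst (Region j) (sym (J-action x y z)) (j-step x y z q≡2 (inj₁ r))
region-step j⌣b⁻¹ (x ∷ y ∷ z ∷ []) q≡2 r =
  subst (Region j) (sym (J-action x y z)) (j-step x y z q≡2 (inj₂ r))

in-own-region : ∀ a w → Reduced (a ∷ w) → Region a (eval (a ∷ w) ·v base)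
in-own-region b   [] _ = Sign.+ , (2 , refl) , (3 , refl)
in-own-region b⁻¹ [] _ = Sign.+ , (0 , refl) , (0 , refl)
in-own-region j   [] _ = inj₁ (0 , refl)
in-own-region a (c ∷ w) (a⌣c ∷ reduced) =
  subst (Region a) (sym (⊗-action ⟦ a ⟧ (eval (c ∷ w)) base))
        (region-step a⌣c (eval (c ∷ w) ·v base) (q-orbit (c ∷ w)) (in-own-region c w reduced))

base-outside : ∀ a → ¬ Region a base
base-outside b   (Sign.+ , _ , (_ , ()))
base-outside b   (Sign.- , _ , (_ , ()))
base-outside b⁻¹ (Sign.+ , _ , (_ , ()))
base-outside b⁻¹ (Sign.- , (_ , ()) , _)
base-outside j   (inj₁ (_ , ()))
base-outside j   (inj₂ (_ , ()))

-- Freeness of the action of H on the orbit of base.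

-- Only the empty reduced word fixes base.
stabiliser-trivial : ∀ {M} → InH M → M ·v base ≡ base → M ≡ I3
stabiliser-trivial h fixes with reduced-word h
... | [] , _ , refl = refl
... | a ∷ w , reduced , refl =
  ⊥-elim (base-outside a (subst (Region a) fixes (in-own-region a w reduced)))

H-inverse : ∀ {M} → InH M → Σ Mat3 λ N → InH N × N ⊗ M ≡ I3 × M ⊗ N ≡ I3
H-inverse h-id   = I3 , h-id , refl , refl
H-inverse h-B    = Binv , h-Binv , refl , refl
H-inverse h-Binv = B , h-B , refl , refl
H-inverse h-J    = J , h-J , refl , refl
H-inverse (h-mul hM hN) with H-inverse hM | H-inverse hN
... | M′ , hM′ , M′M≡I , MM′≡I | N′ , hN′ , N′N≡I , NN′≡I =
  N′ ⊗ M′ , h-mul hN′ hM′ , product-inverse M′M≡I N′N≡I , product-inverse NN′≡I MM′≡I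

orbit-injective : ∀ {M N} → InH M → InH N → M ·v base ≡ N ·v base → M ≡ N
orbit-injective {M} {N} hM hN same with H-inverse hM
... | M′ , hM′ , M′M≡I , MM′≡I = begin
  M                  ≡⟨ sym (⊗-identityʳ M) ⟩
  M ⊗ I3             ≡⟨ cong (M ⊗_) (sym (stabiliser-trivial (h-mul hM′ hN) fixes)) ⟩
  M ⊗ (M′ ⊗ N)       ≡⟨ cancel-left N MM′≡I ⟩
  N                  ∎
  where
  open ≡-Reasoning
  fixes : (M′ ⊗ N) ·v base ≡ base
  fixes = begin
    (M′ ⊗ N) ·v base    ≡⟨ ⊗-action M′ N base ⟩
    M′ ·v (N ·v base)   ≡⟨ cong (M′ ·v_) (sym same) ⟩
    M′ ·v (M ·v base)   ≡⟨ sym (⊗-action M′ M base) ⟩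
    (M′ ⊗ M) ·v base    ≡⟨ cong (_·v base) M′M≡I ⟩
    base                ∎

M-determined : ∀ {C M1 M3 M1inv v1 v3} → InH C → InH M1 → InH M3 →
  M1 ·v base ≡ v1 → M3 ·v base ≡ v3 → M1 ⊗ M1inv ≡ I3 →
  C ·v v1 ≡ J ·v v3 → (J ⊗ M3) ⊗ M1inv ≡ C
M-determined {C} {M1} {M3} {M1inv} {v1} {v3} hC h1 h3 e1 e3 M1M1inv≡I shift = begin
  (J ⊗ M3) ⊗ M1inv  ≡⟨ cong (_⊗ M1inv) JM3≡CM1 ⟩
  (C ⊗ M1) ⊗ M1inv  ≡⟨ ⊗-assoc C M1 M1inv ⟩
  C ⊗ (M1 ⊗ M1inv)  ≡⟨ cong (C ⊗_) M1M1inv≡I ⟩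
  C ⊗ I3            ≡⟨ ⊗-identityʳ C ⟩
  C                 ∎
  where
  open ≡-Reasoning
  JM3≡CM1 : J ⊗ M3 ≡ C ⊗ M1
  JM3≡CM1 = orbit-injective (h-mul h-J h3) (h-mul hC h1) (begin
    (J ⊗ M3) ·v base   ≡⟨ ⊗-action J M3 base ⟩
    J ·v (M3 ·v base)  ≡⟨ cong (J ·v_) e3 ⟩
    J ·v v3            ≡⟨ sym shift ⟩
    C ·v v1            ≡⟨ cong (C ·v_) (sym e1) ⟩
    C ·v (M1 ·v base)  ≡⟨ sym (⊗-action C M1 base) ⟩
    (C ⊗ M1) ·v base   ∎)

-- Sign analysis of trivial canonical sequences.

square-root : ∀ x y → sq x ≡ sq y → x ≡ y ⊎ x ≡ - y
square-root x y x²≡y² =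
  Sum.map (i-j≡0⇒i≡j x y) (i-j≡0⇒i≡j x (- y)) (i*j≡0⇒i≡0∨j≡0 (x - y) product≡0)
  where
  open ≡-Reasoning
  factor : ∀ x y → (x - y) * (x - - y) ≡ x * x - y * y
  factor = solve-∀
  product≡0 : (x - y) * (x - - y) ≡ + 0
  product≡0 = begin
    (x - y) * (x - - y)  ≡⟨ factor x y ⟩
    x * x - y * y        ≡⟨ cong (_- y * y) x²≡y² ⟩
    y * y - y * y        ≡⟨ +-inverseʳ (y * y) ⟩
    + 0                  ∎

not-divisible : ∀ k c {k∤c : False (k ∣? c)} → ¬ k ∣ₛ c
not-divisible k c {k∤c} = toWitnessFalse k∤c

mod8 : ∀ x r → x ≡₈ r → + 8 ∣ₛ x - r
mod8 x r = ∣ᵤ⇒∣ {+ 8} {x - r}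

ends-congruent : ∀ x1 x5 → x1 ≡₈ + 2 → x5 ≡₈ + 2 → + 8 ∣ₛ x5 - x1
ends-congruent x1 x5 c1 c5 =
  subst (+ 8 ∣ₛ_) (difference x1 x5) (∣m∣n⇒∣m-n (mod8 x5 (+ 2) c5) (mod8 x1 (+ 2) c1))
  where
  difference : ∀ x1 x5 → (x5 - + 2) - (x1 - + 2) ≡ x5 - x1
  difference = solve-∀

residue-sum : ∀ {x2 x4} r₄ r₂ → x4 ≡₈ r₄ → x2 ≡₈ r₂ → + 4 ∣ₛ r₄ + r₂ → + 4 ∣ₛ x2 + x4
residue-sum {x2} {x4} r₄ r₂ c4 c2 4∣r₄+r₂ =
  subst (+ 4 ∣ₛ_) (regroup r₄ r₂ x2 x4)
    (∣m∣n⇒∣m+n (∣-trans (divides (+ 2) refl) (∣m∣n⇒∣m+n (mod8 x4 r₄ c4) (mod8 x2 r₂ c2))) 4∣r₄+r₂)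
  where
  regroup : ∀ r₄ r₂ x2 x4 → ((x4 - r₄) + (x2 - r₂)) + (r₄ + r₂) ≡ x2 + x4
  regroup = solve-∀

MiddleResidues : ℤ → ℤ → Set
MiddleResidues x2 x4 =
    (((x4 ≡₈ + 1) ⊎ (x4 ≡₈ - + 3)) × ((x2 ≡₈ - + 1) ⊎ (x2 ≡₈ + 3)))
  ⊎ (((x4 ≡₈ - + 1) ⊎ (x4 ≡₈ + 3)) × ((x2 ≡₈ + 1) ⊎ (x2 ≡₈ - + 3)))

middle-sum : ∀ x2 x4 → MiddleResidues x2 x4 → + 4 ∣ₛ x2 + x4
middle-sum x2 x4 (inj₁ (inj₁ c4 , inj₁ c2)) = residue-sum {x2} {x4} (+ 1) (- + 1) c4 c2 (divides (+ 0) refl)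
middle-sum x2 x4 (inj₁ (inj₁ c4 , inj₂ c2)) = residue-sum {x2} {x4} (+ 1) (+ 3) c4 c2 (divides (+ 1) refl)
middle-sum x2 x4 (inj₁ (inj₂ c4 , inj₁ c2)) = residue-sum {x2} {x4} (- + 3) (- + 1) c4 c2 (divides (- + 1) refl)
middle-sum x2 x4 (inj₁ (inj₂ c4 , inj₂ c2)) = residue-sum {x2} {x4} (- + 3) (+ 3) c4 c2 (divides (+ 0) refl)
middle-sum x2 x4 (inj₂ (inj₁ c4 , inj₁ c2)) = residue-sum {x2} {x4} (- + 1) (+ 1) c4 c2 (divides (+ 0) refl)
middle-sum x2 x4 (inj₂ (inj₁ c4 , inj₂ c2)) = residue-sum {x2} {x4} (- + 1) (- + 3) c4 c2 (divides (- + 1) refl)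
middle-sum x2 x4 (inj₂ (inj₂ c4 , inj₁ c2)) = residue-sum {x2} {x4} (+ 3) (+ 1) c4 c2 (divides (+ 1) refl)
middle-sum x2 x4 (inj₂ (inj₂ c4 , inj₂ c2)) = residue-sum {x2} {x4} (+ 3) (- + 3) c4 c2 (divides (+ 0) refl)

Shift : Mat3 → ℤ → ℤ → ℤ → ℤ → ℤ → Set
Shift C x1 x2 x3 x4 x5 = C ·v (x1 ∷ x2 ∷ x3 ∷ []) ≡ J ·v (x3 ∷ x4 ∷ x5 ∷ [])

B-shift : ∀ x1 x2 x3 x4 x5 → + 3 * x1 + + 4 * x2 ≡ x5 → + 2 * x1 + + 3 * x2 ≡ x4 →
          Shift B x1 x2 x3 x4 x5
B-shift x1 x2 x3 x4 x5 e5 e4 =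
  trans (B-action x1 x2 x3) (trans (≡-vec3 e5 e4 refl) (sym (J-action x3 x4 x5)))

Binv-shift : ∀ x1 x2 x3 x4 x5 → + 3 * x1 + - + 4 * x2 ≡ x5 → - + 2 * x1 + + 3 * x2 ≡ x4 →
             Shift Binv x1 x2 x3 x4 x5
Binv-shift x1 x2 x3 x4 x5 e5 e4 =
  trans (Binv-action x1 x2 x3) (trans (≡-vec3 e5 e4 refl) (sym (J-action x3 x4 x5)))

-- With x_i = ±(m+i): equal signs at the ends give x₅ − x₁ = ±4, which is
-- incompatible with x₁ ≡ x₅ ≡ 2 (mod 8).
ends-same-sign₊ : ∀ m → m + + 1 ≡₈ + 2 → ¬ m + + 5 ≡₈ + 2
ends-same-sign₊ m c1 c5 =
  not-divisible (+ 8) (+ 4) (subst (+ 8 ∣ₛ_) (gap m) (ends-congruent (m + + 1) (m + + 5) c1 c5))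
  where
  gap : ∀ m → (m + + 5) - (m + + 1) ≡ + 4
  gap = solve-∀

ends-same-sign₋ : ∀ m → - (m + + 1) ≡₈ + 2 → ¬ - (m + + 5) ≡₈ + 2
ends-same-sign₋ m c1 c5 =
  not-divisible (+ 8) (- + 4)
    (subst (+ 8 ∣ₛ_) (gap m) (ends-congruent (- (m + + 1)) (- (m + + 5)) c1 c5))
  where
  gap : ∀ m → - (m + + 5) - - (m + + 1) ≡ - + 4
  gap = solve-∀

-- Opposite signs in the middle give x₂ + x₄ = ±2, excluded by middle-sum.
middle-opposite-signs₊ : ∀ m → ¬ MiddleResidues (m + + 2) (- (m + + 4))
middle-opposite-signs₊ m middle =
  not-divisible (+ 4) (- + 2) (subst (+ 4 ∣ₛ_) (gap m) (middle-sum (m + + 2) (- (m + + 4)) middle))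
  where
  gap : ∀ m → (m + + 2) + - (m + + 4) ≡ - + 2
  gap = solve-∀

middle-opposite-signs₋ : ∀ m → ¬ MiddleResidues (- (m + + 2)) (m + + 4)
middle-opposite-signs₋ m middle =
  not-divisible (+ 4) (+ 2) (subst (+ 4 ∣ₛ_) (gap m) (middle-sum (- (m + + 2)) (m + + 4) middle))
  where
  gap : ∀ m → - (m + + 2) + (m + + 4) ≡ + 2
  gap = solve-∀

-- The four remaining sign patterns (signs of x₁, x₂, x₄, x₅):
-- (−,+,+,+) and (+,−,−,−) are shifts by B, (+,+,+,−) and (−,−,−,+) by B⁻¹.
B-pattern : ∀ m x3 → Shift B (- (m + + 1)) (m + + 2) x3 (m + + 4) (m + + 5)
B-pattern m x3 = B-shift (- (m + + 1)) (m + + 2) x3 (m + + 4) (m + + 5) (e₅ m) (e₄ m)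
  where
  e₅ : ∀ m → + 3 * - (m + + 1) + + 4 * (m + + 2) ≡ m + + 5
  e₅ = solve-∀
  e₄ : ∀ m → + 2 * - (m + + 1) + + 3 * (m + + 2) ≡ m + + 4
  e₄ = solve-∀

B-pattern′ : ∀ m x3 → Shift B (m + + 1) (- (m + + 2)) x3 (- (m + + 4)) (- (m + + 5))
B-pattern′ m x3 = B-shift (m + + 1) (- (m + + 2)) x3 (- (m + + 4)) (- (m + + 5)) (e₅ m) (e₄ m)
  where
  e₅ : ∀ m → + 3 * (m + + 1) + + 4 * - (m + + 2) ≡ - (m + + 5)
  e₅ = solve-∀
  e₄ : ∀ m → + 2 * (m + + 1) + + 3 * - (m + + 2) ≡ - (m + + 4)
  e₄ = solve-∀

Binv-pattern : ∀ m x3 → Shift Binv (m + + 1) (m + + 2) x3 (m + + 4) (- (m + + 5))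
Binv-pattern m x3 = Binv-shift (m + + 1) (m + + 2) x3 (m + + 4) (- (m + + 5)) (e₅ m) (e₄ m)
  where
  e₅ : ∀ m → + 3 * (m + + 1) + - + 4 * (m + + 2) ≡ - (m + + 5)
  e₅ = solve-∀
  e₄ : ∀ m → - + 2 * (m + + 1) + + 3 * (m + + 2) ≡ m + + 4
  e₄ = solve-∀

Binv-pattern′ : ∀ m x3 → Shift Binv (- (m + + 1)) (- (m + + 2)) x3 (- (m + + 4)) (m + + 5)
Binv-pattern′ m x3 = Binv-shift (- (m + + 1)) (- (m + + 2)) x3 (- (m + + 4)) (m + + 5) (e₅ m) (e₄ m)
  where
  e₅ : ∀ m → + 3 * - (m + + 1) + - + 4 * - (m + + 2) ≡ m + + 5
  e₅ = solve-∀
  e₄ : ∀ m → - + 2 * - (m + + 1) + + 3 * - (m + + 2) ≡ - (m + + 4)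
  e₄ = solve-∀

-- A trivial canonical sequence is a shift by B or by B⁻¹: of the sixteen
-- sign patterns in x_i = ±(m+i), the congruences leave only the four above.
trivial-shift : ∀ x1 x2 x3 x4 x5 → IsCanonical5 x1 x2 x3 x4 x5 → IsTrivial5 x1 x2 x3 x4 x5 →
                Shift B x1 x2 x3 x4 x5 ⊎ Shift Binv x1 x2 x3 x4 x5
trivial-shift x1 x2 x3 x4 x5 (c1 , c5 , middle) (m , s1 , s2 , _ , s4 , s5)
  with square-root x1 (m + + 1) s1 | square-root x2 (m + + 2) s2
     | square-root x4 (m + + 4) s4 | square-root x5 (m + + 5) s5
... | inj₁ refl | _         | _         | inj₁ refl = ⊥-elim (ends-same-sign₊ m c1 c5)
... | inj₂ refl | _         | _         | inj₂ refl = ⊥-elim (ends-same-sign₋ m c1 c5)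
... | _         | inj₁ refl | inj₂ refl | _         = ⊥-elim (middle-opposite-signs₊ m middle)
... | _         | inj₂ refl | inj₁ refl | _         = ⊥-elim (middle-opposite-signs₋ m middle)
... | inj₂ refl | inj₁ refl | inj₁ refl | inj₁ refl = inj₁ (B-pattern m x3)
... | inj₁ refl | inj₂ refl | inj₂ refl | inj₂ refl = inj₁ (B-pattern′ m x3)
... | inj₁ refl | inj₁ refl | inj₁ refl | inj₂ refl = inj₂ (Binv-pattern m x3)
... | inj₂ refl | inj₂ refl | inj₂ refl | inj₁ refl = inj₂ (Binv-pattern′ m x3)

lemma9p4 : (x1 x2 x3 x4 x5 : ℤ) →
    IsBuchi5 x1 x2 x3 x4 x5 → IsCanonical5 x1 x2 x3 x4 x5 →
    (M1 M3 M1inv : Mat3) → InH M1 → InH M3 →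
    M1 ·v base ≡ (x1 ∷ x2 ∷ x3 ∷ []) → M3 ·v base ≡ (x3 ∷ x4 ∷ x5 ∷ []) →
    M1 ⊗ M1inv ≡ I3 → M1inv ⊗ M1 ≡ I3 →
    IsTrivial5 x1 x2 x3 x4 x5 →
    ((J ⊗ M3) ⊗ M1inv ≡ B) ⊎ ((J ⊗ M3) ⊗ M1inv ≡ Binv)
lemma9p4 x1 x2 x3 x4 x5 _ canonical M1 M3 M1inv h1 h3 e1 e3 M1M1inv≡I _ trivial =
  Sum.map (M-determined h-B h1 h3 e1 e3 M1M1inv≡I)
          (M-determined h-Binv h1 h3 e1 e3 M1M1inv≡I)
          (trivial-shift x1 x2 x3 x4 x5 canonical trivial)
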